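{- Suppose $\mu \succ \kappa \prec \nu$ are $d$-partitions and $m$ is a nonnegative integer. Also, suppose that $\kappa_d=0$ or $m=0$. Then there exists a unique $d$-partition $\rho$ such that the cell with entry $m$ and corner partitions $\kappa$ (bottom-left), $\mu$ (top-left), $\nu$ (bottom-right), $\rho$ (top-right) satisfies the $d$-RSK local rule.
   Context: A partition is a finite weakly decreasing sequence of positive integers $\lambda=(\lambda_1,\ldots,\lambda_m)$; its length $\ell(\lambda)$ is the number of parts, and one sets $\lambda_i=0$ for $i>\ell(\lambda)$. A $d$-partition is a partition of length at most $d$. For partitions $\alpha,\beta$, write $\alpha \prec \beta$ (equivalently $\beta\succ\alpha$, "$\alpha$ interlaces $\beta$") if $\beta_1 \geq \alpha_1 \geq \beta_2 \geq \alpha_2 \geq \beta_3 \geq \cdots$. A cell is a unit square carrying a nonnegative integer entry $m$ and four partitions at its corners: $\kappa$ at the bottom-left, $\mu$ at the top-left, $\nu$ at the bottom-right, $\rho$ at the top-right. The cell satisfies the $d$-RSK local rule if: $\mu \succ \kappa \prec \nu$ and $\mu \prec \rho \succ \nu$; all four of $\kappa,\mu,\nu,\rho$ are $d$-partitions; $m=0$ or $\kappa_d=0$; and $\rho_1+\kappa_d = m+\min(\mu_d,\nu_d)+\max(\mu_1,\nu_1)$ and $\rho_i+\kappa_{i-1} = \min(\mu_{i-1},\nu_{i-1})+\max(\mu_i,\nu_i)$ for $2\le i\le d$. -}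

module Defs where

open import Data.Nat using (ℕ; zero; suc; _+_; _≤_; _≥_; _<_; _⊓_; _⊔_)
open import Data.List using (List; []; _∷_; length)
open import Data.List.Relation.Unary.All using (All)
open import Data.List.Relation.Unary.Linked using (Linked)
open import Data.Product using (_×_)
open import Data.Sum using (_⊎_)
open import Relation.Binary.PropositionalEquality using (_≡_)

record IsPartition (λ' : List ℕ) : Set where
  field
    positive   : All (λ x → 1 ≤ x) λ'
    decreasing : Linked _≥_ λ'

-- part λ i = λ_i (1-indexed), with λ_i = 0 for i > ℓ(λ); also λ_0 := 0 (never used).
part : List ℕ → ℕ → ℕ
part []       _             = 0
part (x ∷ xs) zero          = 0
part (x ∷ xs) (suc zero)    = x
part (x ∷ xs) (suc (suc i)) = part xs (suc i)

IsDPartition : ℕ → List ℕ → Set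
IsDPartition d λ' = IsPartition λ' × length λ' ≤ d

_≺_ : List ℕ → List ℕ → Set
α ≺ β = ∀ (i : ℕ) → 1 ≤ i → (part α i ≤ part β i) × (part β (suc i) ≤ part α i)

record LocalRule (d m : ℕ) (κ μ ν ρ : List ℕ) : Set where
  field
    μ≻κ  : κ ≺ μ
    κ≺ν  : κ ≺ ν
    μ≺ρ  : μ ≺ ρ
    ρ≻ν  : ν ≺ ρ
    κ-d  : IsDPartition d κ
    μ-d  : IsDPartition d μ
    ν-d  : IsDPartition d ν
    ρ-d  : IsDPartition d ρ
    zero-cond : m ≡ 0 ⊎ part κ d ≡ 0
    eq₁  : part ρ 1 + part κ d ≡ m + (part μ d ⊓ part ν d) + (part μ 1 ⊔ part ν 1)
    eqᵢ  : ∀ (i : ℕ) → 2 ≤ i → i ≤ d →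
           part ρ i + part κ (i Data.Nat.∸ 1)
             ≡ (part μ (i Data.Nat.∸ 1) ⊓ part ν (i Data.Nat.∸ 1)) + (part μ i ⊔ part ν i)

module Submission where

open import Defs
open import Data.Nat using (ℕ; _≤_)
open import Data.List using (List)
open import Data.Product using (∃!; _×_)
open import Data.Sum using (_⊎_)
open import Relation.Binary.PropositionalEquality using (_≡_)

open import Data.Nat using (zero; suc; _+_; _∸_; _<_; _≥_; _⊓_; _⊔_; z≤n; s≤s; _≤?_)
open import Data.Nat.Properties
open import Data.List using ([]; _∷_; length)
open import Data.List.Relation.Unary.All using (All; []; _∷_)
open import Data.List.Relation.Unary.Linked using (Linked; []; [-]; _∷_)
open import Data.Product using (_,_; proj₁; proj₂)
open import Data.Sum using (swap)
open import Function using (_∘_)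
open import Relation.Binary.PropositionalEquality using (refl; sym; trans; cong; cong₂; subst; subst₂)
open import Relation.Nullary using (yes; no; contradiction)

-- Write a = μ, b = ν, k = κ and let prev 1 = d, prev i = i − 1 for i ≥ 2.
-- The local rule says ρ_i + k_{prev i} = c_i + (a ⊓ b)_{prev i} + (a ⊔ b)_i for 1 ≤ i ≤ d,
-- where c_1 = m and c_i = 0 otherwise, so ρ_i is forced for i ≤ d, and ρ_i = 0 for i > d
-- because ρ is a d-partition; this gives uniqueness. For existence take this forced
-- value. Interlacing k ≺ a, b gives k_j ≤ (a ⊓ b)_j and (a ⊔ b)_{j+1} ≤ k_j, whence
-- (a ⊔ b)_i ≤ ρ_i and ρ_{i+1} ≤ (a ⊓ b)_i: ρ interlaces a and b and is weakly decreasing.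

part-beyond-length : ∀ (xs : List ℕ) d i → length xs ≤ d → d < i → part xs i ≡ 0
part-beyond-length []       d       i             _         _         = refl
part-beyond-length (x ∷ xs) zero    (suc i)       ()        _
part-beyond-length (x ∷ xs) (suc d) (suc zero)    _         (s≤s ())
part-beyond-length (x ∷ xs) (suc d) (suc (suc i)) (s≤s ℓ≤d) (s≤s d<i) =
  part-beyond-length xs d (suc i) ℓ≤d d<i

part-injective : ∀ (xs ys : List ℕ) → All (1 ≤_) xs → All (1 ≤_) ys →
                 (∀ i → 1 ≤ i → part xs i ≡ part ys i) → xs ≡ ys
part-injective []       []       _          _          _  = refl
part-injective []       (y ∷ ys) _          (1≤y ∷ _)  eq =
  contradiction (subst (1 ≤_) (sym (eq 1 (s≤s z≤n))) 1≤y) λ ()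
part-injective (x ∷ xs) []       (1≤x ∷ _)  _          eq =
  contradiction (subst (1 ≤_) (eq 1 (s≤s z≤n)) 1≤x) λ ()
part-injective (x ∷ xs) (y ∷ ys) (_ ∷ xs⁺) (_ ∷ ys⁺) eq =
  cong₂ _∷_ (eq 1 (s≤s z≤n)) (part-injective xs ys xs⁺ ys⁺ λ where
    (suc j) _ → eq (suc (suc j)) (s≤s z≤n))

-- Weakly decreasing from index 1 on; index 0 is excluded since part _ 0 = 0.
Antitone : (ℕ → ℕ) → Set
Antitone f = ∀ i → 1 ≤ i → f (suc i) ≤ f i

antitone-tail : ∀ {f} → Antitone f → Antitone (f ∘ suc)
antitone-tail f↓ i _ = f↓ (suc i) (s≤s z≤n)

antitone-≤-first : ∀ {f} → Antitone f → ∀ j → f (suc j) ≤ f 1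
antitone-≤-first f↓ zero    = ≤-refl
antitone-≤-first f↓ (suc j) = ≤-trans (f↓ (suc j) (s≤s z≤n)) (antitone-≤-first f↓ j)

antitone-part-tail : ∀ {x} {xs : List ℕ} → Antitone (part (x ∷ xs)) → Antitone (part xs)
antitone-part-tail xs↓ (suc j) _ = xs↓ (suc (suc j)) (s≤s z≤n)

linked-≥-from-part : ∀ (xs : List ℕ) → Antitone (part xs) → Linked _≥_ xs
linked-≥-from-part []           _  = []
linked-≥-from-part (x ∷ [])     _  = [-]
linked-≥-from-part (x ∷ y ∷ ys) xs↓ = xs↓ 1 (s≤s z≤n) ∷ linked-≥-from-part (y ∷ ys) (antitone-part-tail xs↓)

fromSequence : ℕ → (ℕ → ℕ) → List ℕ
fromSequence zero    f = []
fromSequence (suc d) f with f 1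
... | zero  = []
... | suc x = suc x ∷ fromSequence d (f ∘ suc)

length-fromSequence : ∀ d f → length (fromSequence d f) ≤ d
length-fromSequence zero    f = z≤n
length-fromSequence (suc d) f with f 1
... | zero  = z≤n
... | suc _ = s≤s (length-fromSequence d (f ∘ suc))

fromSequence-positive : ∀ d f → All (1 ≤_) (fromSequence d f)
fromSequence-positive zero    f = []
fromSequence-positive (suc d) f with f 1
... | zero  = []
... | suc _ = s≤s z≤n ∷ fromSequence-positive d (f ∘ suc)

part-fromSequence : ∀ d f → Antitone f → (∀ i → d < i → f i ≡ 0) →
                    ∀ i → 1 ≤ i → part (fromSequence d f) i ≡ f i
part-fromSequence zero    f f↓ f-vanishes i 1≤i = sym (f-vanishes i 1≤i)
part-fromSequence (suc d) f f↓ f-vanishes i 1≤i with f 1 in f₁≡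
part-fromSequence (suc d) f f↓ f-vanishes (suc j) _ | zero =
  sym (n≤0⇒n≡0 (subst (f (suc j) ≤_) f₁≡ (antitone-≤-first f↓ j)))
part-fromSequence (suc d) f f↓ f-vanishes (suc zero) _ | suc _ = sym f₁≡
part-fromSequence (suc d) f f↓ f-vanishes (suc (suc j)) _ | suc _ =
  part-fromSequence d (f ∘ suc) (antitone-tail f↓) (λ i d<i → f-vanishes (suc i) (s≤s d<i))
    (suc j) (s≤s z≤n)

fromSequence-isDPartition : ∀ d f → Antitone f → (∀ i → d < i → f i ≡ 0) →
                            IsDPartition d (fromSequence d f)
fromSequence-isDPartition d f f↓ f-vanishes =
  record { positive   = fromSequence-positive d f
         ; decreasing = linked-≥-from-part xs λ i 1≤i →
             subst₂ _≤_ (sym (part-xs (suc i) (s≤s z≤n))) (sym (part-xs i 1≤i)) (f↓ i 1≤i) }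
  , length-fromSequence d f
  where
  xs : List ℕ
  xs = fromSequence d f

  part-xs : ∀ i → 1 ≤ i → part xs i ≡ f i
  part-xs = part-fromSequence d f f↓ f-vanishes

n≤[m+n]∸o : ∀ m n {o} → o ≤ m → n ≤ (m + n) ∸ o
n≤[m+n]∸o m n {o} o≤m = ≤-trans (m≤n+m n (m ∸ o)) (≤-reflexive (sym (+-∸-comm n o≤m)))

[m+n]∸o≤m : ∀ m {n o} → n ≤ o → (m + n) ∸ o ≤ m
[m+n]∸o≤m m {n} n≤o = ≤-trans (∸-monoʳ-≤ (m + n) n≤o) (≤-reflexive (m+n∸n≡m m n))

module LocalRuleSolution (d m : ℕ) (κ μ ν : List ℕ) (κ≺μ : κ ≺ μ) (κ≺ν : κ ≺ ν)
                         (μ-length : length μ ≤ d) (ν-length : length ν ≤ d) where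

  lo hi : ℕ → ℕ
  lo i = part μ i ⊓ part ν i
  hi i = part μ i ⊔ part ν i

  κ≤lo : ∀ i → 1 ≤ i → part κ i ≤ lo i
  κ≤lo i 1≤i = ⊓-glb (proj₁ (κ≺μ i 1≤i)) (proj₁ (κ≺ν i 1≤i))

  hi-suc≤κ : ∀ i → 1 ≤ i → hi (suc i) ≤ part κ i
  hi-suc≤κ i 1≤i = ⊔-lub (proj₂ (κ≺μ i 1≤i)) (proj₂ (κ≺ν i 1≤i))

  hi-vanishes : ∀ i → d < i → hi i ≡ 0
  hi-vanishes i d<i rewrite part-beyond-length μ d i μ-length d<i
                          | part-beyond-length ν d i ν-length d<i = refl

  prev carry : ℕ → ℕ
  prev zero          = zero
  prev (suc zero)    = d
  prev (suc (suc j)) = suc j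
  carry zero          = 0
  carry (suc zero)    = m
  carry (suc (suc j)) = 0

  rowSum : ℕ → ℕ
  rowSum i = carry i + lo (prev i) + hi i

  κ-prev≤lo-prev : ∀ i → 1 ≤ i → i ≤ d → part κ (prev i) ≤ lo (prev i)
  κ-prev≤lo-prev (suc zero)    _ 1≤d = κ≤lo d 1≤d
  κ-prev≤lo-prev (suc (suc j)) _ _   = κ≤lo (suc j) (s≤s z≤n)

  κ-prev≤carry+lo-prev : ∀ i → 1 ≤ i → i ≤ d → part κ (prev i) ≤ carry i + lo (prev i)
  κ-prev≤carry+lo-prev i 1≤i i≤d = ≤-trans (κ-prev≤lo-prev i 1≤i i≤d) (m≤n+m _ (carry i))

  ρ-seq : ℕ → ℕ
  ρ-seq zero = 0
  ρ-seq (suc i) with suc i ≤? d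
  ... | yes _ = rowSum (suc i) ∸ part κ (prev (suc i))
  ... | no  _ = 0

  ρ-seq-row : ∀ i → 1 ≤ i → i ≤ d → ρ-seq i + part κ (prev i) ≡ rowSum i
  ρ-seq-row (suc i) 1≤i i≤d with suc i ≤? d
  ... | yes _   = m∸n+n≡m (≤-trans (κ-prev≤carry+lo-prev (suc i) 1≤i i≤d) (m≤m+n _ _))
  ... | no  i≰d = contradiction i≤d i≰d

  ρ-seq-vanishes : ∀ i → d < i → ρ-seq i ≡ 0
  ρ-seq-vanishes (suc i) d<i with suc i ≤? d
  ... | yes i≤d = contradiction i≤d (<⇒≱ d<i)
  ... | no  _   = refl

  hi≤ρ-seq : ∀ i → 1 ≤ i → hi i ≤ ρ-seq i
  hi≤ρ-seq (suc i) 1≤i with suc i ≤? d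
  ... | yes i≤d = n≤[m+n]∸o _ (hi (suc i)) (κ-prev≤carry+lo-prev (suc i) 1≤i i≤d)
  ... | no  i≰d = ≤-reflexive (hi-vanishes (suc i) (≰⇒> i≰d))

  ρ-seq-suc≤lo : ∀ i → 1 ≤ i → ρ-seq (suc i) ≤ lo i
  ρ-seq-suc≤lo (suc j) 1≤i with suc (suc j) ≤? d
  ... | yes _ = [m+n]∸o≤m (lo (suc j)) (hi-suc≤κ (suc j) 1≤i)
  ... | no  _ = z≤n

  ρ-seq-antitone : Antitone ρ-seq
  ρ-seq-antitone i 1≤i =
    ≤-trans (ρ-seq-suc≤lo i 1≤i) (≤-trans (m⊓n≤m⊔n (part μ i) (part ν i)) (hi≤ρ-seq i 1≤i))

  part-forced : ∀ {ρ'} → length ρ' ≤ d →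
                (∀ i → 1 ≤ i → i ≤ d → part ρ' i + part κ (prev i) ≡ rowSum i) →
                ∀ i → 1 ≤ i → part ρ' i ≡ ρ-seq i
  part-forced {ρ'} ρ'-length row i 1≤i with i ≤? d
  ... | yes i≤d = +-cancelʳ-≡ _ _ _ (trans (row i 1≤i i≤d) (sym (ρ-seq-row i 1≤i i≤d)))
  ... | no  i≰d = trans (part-beyond-length ρ' d i ρ'-length (≰⇒> i≰d))
                        (sym (ρ-seq-vanishes i (≰⇒> i≰d)))

  localRule-row : ∀ {ρ'} → LocalRule d m κ μ ν ρ' →
                  ∀ i → 1 ≤ i → i ≤ d → part ρ' i + part κ (prev i) ≡ rowSum i
  localRule-row R (suc zero)    _ _   = LocalRule.eq₁ R
  localRule-row R (suc (suc j)) _ i≤d = LocalRule.eqᵢ R (suc (suc j)) (s≤s (s≤s z≤n)) i≤d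

  ρ : List ℕ
  ρ = fromSequence d ρ-seq

  ρ-isDPartition : IsDPartition d ρ
  ρ-isDPartition = fromSequence-isDPartition d ρ-seq ρ-seq-antitone ρ-seq-vanishes

  part-ρ : ∀ i → 1 ≤ i → part ρ i ≡ ρ-seq i
  part-ρ = part-fromSequence d ρ-seq ρ-seq-antitone ρ-seq-vanishes

  ρ-row : ∀ i → 1 ≤ i → i ≤ d → part ρ i + part κ (prev i) ≡ rowSum i
  ρ-row i 1≤i i≤d = trans (cong (_+ part κ (prev i)) (part-ρ i 1≤i)) (ρ-seq-row i 1≤i i≤d)

  ρ-eqᵢ : ∀ i → 2 ≤ i → i ≤ d → part ρ i + part κ (i ∸ 1) ≡ lo (i ∸ 1) + hi i
  ρ-eqᵢ (suc zero)    (s≤s ()) _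
  ρ-eqᵢ (suc (suc j)) _ i≤d = ρ-row (suc (suc j)) (s≤s z≤n) i≤d

  hi≤ρ : ∀ i → 1 ≤ i → hi i ≤ part ρ i
  hi≤ρ i 1≤i = subst (hi i ≤_) (sym (part-ρ i 1≤i)) (hi≤ρ-seq i 1≤i)

  ρ-suc≤lo : ∀ i → 1 ≤ i → part ρ (suc i) ≤ lo i
  ρ-suc≤lo i 1≤i = subst (_≤ lo i) (sym (part-ρ (suc i) (s≤s z≤n))) (ρ-seq-suc≤lo i 1≤i)

  μ≺ρ : μ ≺ ρ
  μ≺ρ i 1≤i = ≤-trans (m≤m⊔n _ _) (hi≤ρ i 1≤i) , ≤-trans (ρ-suc≤lo i 1≤i) (m⊓n≤m _ _)

  ν≺ρ : ν ≺ ρ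
  ν≺ρ i 1≤i = ≤-trans (m≤n⊔m _ _) (hi≤ρ i 1≤i) , ≤-trans (ρ-suc≤lo i 1≤i) (m⊓n≤n _ _)

  ρ-unique : ∀ {ρ'} → IsDPartition d ρ' → LocalRule d m κ μ ν ρ' → ρ ≡ ρ'
  ρ-unique {ρ'} (ρ'-partition , ρ'-length) R =
    part-injective ρ ρ' (IsPartition.positive (proj₁ ρ-isDPartition)) (IsPartition.positive ρ'-partition)
      λ i 1≤i → trans (part-ρ i 1≤i) (sym (part-forced {ρ'} ρ'-length (localRule-row R) i 1≤i))

lemma6p1 : (d : ℕ) → 1 ≤ d → (m : ℕ) → (κ μ ν : List ℕ) →
    IsDPartition d κ → IsDPartition d μ → IsDPartition d ν →
    κ ≺ μ → κ ≺ ν → (part κ d ≡ 0 ⊎ m ≡ 0) →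
    ∃! _≡_ (λ (ρ : List ℕ) → IsDPartition d ρ × LocalRule d m κ μ ν ρ)
lemma6p1 d 1≤d m κ μ ν κ-d μ-d ν-d κ≺μ κ≺ν κ-d≡0⊎m≡0 = ρ , (ρ-isDPartition , rule) , uniq
  where
  open LocalRuleSolution d m κ μ ν κ≺μ κ≺ν (proj₂ μ-d) (proj₂ ν-d)

  rule : LocalRule d m κ μ ν ρ
  rule = record
    { μ≻κ = κ≺μ ; κ≺ν = κ≺ν ; μ≺ρ = μ≺ρ ; ρ≻ν = ν≺ρ
    ; κ-d = κ-d ; μ-d = μ-d ; ν-d = ν-d ; ρ-d = ρ-isDPartition
    -- the construction never uses this hypothesis; the rule merely records it
    ; zero-cond = swap κ-d≡0⊎m≡0
    ; eq₁ = ρ-row 1 (s≤s z≤n) 1≤d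
    ; eqᵢ = ρ-eqᵢ
    }

  uniq : ∀ {ρ'} → IsDPartition d ρ' × LocalRule d m κ μ ν ρ' → ρ ≡ ρ'
  uniq (ρ'-d , R) = ρ-unique ρ'-d R
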